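{- Every $12$-cap of dimension $7$ in $\mathbb{Z}_2^n$ has a basis of extended type $5\text{ - }5\text{ - }5\text{ - }5\text{ - }(2,3,3,3,3,3)$.
   Context: Work in $\mathbb{Z}_2^n$. An affine combination of a set is a sum of an odd number of its distinct elements; $\operatorname{aff}(S)$ is the set of all affine combinations of elements of $S$, and the dimension of $S$ is the dimension of the affine flat $\operatorname{aff}(S)$. A basis for $S$ is a subset $B\subseteq S$ that is affinely independent (no element is an affine combination of the others) with $\operatorname{aff}(B)=\operatorname{aff}(S)$; its dependent set is $D=S\setminus B$. For $x\in D$, $B_x$ is the unique subset of $B$ whose elements sum to $x$. A quad is a set of four distinct elements summing to $\mathbf{0}$; a cap is a quad-free subset; a $k$-cap is a cap with $k$ elements. For $|D|=4$, a basis $B$ has extended type $n_1\text{ - }n_2\text{ - }n_3\text{ - }n_4\text{ - }(m_{12},m_{13},m_{14},m_{23},m_{24},m_{34})$ (pairs in lexicographic order) if the elements of $D$ can be labeled $x_1,\dots,x_4$ so that $|B_{x_i}|=n_i$ for each $i$ and $|B_{x_i}\cap B_{x_j}|=m_{ij}$ for all $i<j$. -}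

module Defs where

open import Data.Nat using (ℕ; zero; suc)
open import Data.Nat.Base using (_%_)
open import Data.Bool using (Bool; true; false; _xor_; if_then_else_)
open import Data.Vec using (Vec; []; _∷_; zipWith; replicate)
open import Data.Fin using (Fin; zero; suc)
open import Data.Fin.Subset using (Subset; _⊆_; _∈_; _-_; ∣_∣; ⊤; ∁; _∩_)
open import Data.Product using (Σ; ∃; _×_; _,_)
open import Function using (_⇔_)
open import Function.Definitions using (Injective)
open import Relation.Binary.PropositionalEquality using (_≡_; _≢_)
open import Relation.Nullary using (¬_)

V : ℕ → Set
V n = Vec Bool n

𝟎 : ∀ {n} → V n
𝟎 {n} = replicate n false

_⊕_ : ∀ {n} → V n → V n → V n
_⊕_ = zipWith _xor_

-- A finite set S ⊆ Z_2^n with k elements is given as an injective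
-- family s : Fin k → V n; subsets of S are subsets of the index set Fin k.

sumOver : ∀ {n k} → (Fin k → V n) → Subset k → V n
sumOver {k = zero}  s []        = 𝟎
sumOver {k = suc k} s (b ∷ p)   =
  (if b then s zero else 𝟎) ⊕ sumOver (λ i → s (suc i)) p

Odd : ℕ → Set
Odd m = m % 2 ≡ 1

-- x is an affine combination of (the elements indexed by) p:
-- a sum of an odd number of distinct elements of p.
AffComb : ∀ {n k} → (Fin k → V n) → Subset k → V n → Set
AffComb s p x = Σ (Subset _) λ t → t ⊆ p × Odd ∣ t ∣ × sumOver s t ≡ x

AffIndep : ∀ {n k} → (Fin k → V n) → Subset k → Set
AffIndep s p = ∀ i → i ∈ p → ¬ AffComb s (p - i) (s i)

IsBasis : ∀ {n k} → (Fin k → V n) → Subset k → Set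
IsBasis s p = AffIndep s p × (∀ x → AffComb s p x ⇔ AffComb s ⊤ x)

HasDim : ∀ {n k} → (Fin k → V n) → ℕ → Set
HasDim s d = Σ (Subset _) λ p → IsBasis s p × ∣ p ∣ ≡ suc d

IsCap : ∀ {n k} → (Fin k → V n) → Set
IsCap s = ∀ a b c d → a ≢ b → a ≢ c → a ≢ d → b ≢ c → b ≢ d → c ≢ d →
  ((s a ⊕ s b) ⊕ (s c ⊕ s d)) ≢ 𝟎

IsKCap : ∀ {n} (k : ℕ) → (Fin k → V n) → Set
IsKCap k s = Injective _≡_ _≡_ s × IsCap s

-- Basis p of S with dependent set D = S \ p of size 4, and a labelling
-- x₁..x₄ (indices d₁..d₄) of D together with the subsets B_{xᵢ} = tᵢ ⊆ p,
-- having |B_{xᵢ}| = nᵢ and |B_{xᵢ} ∩ B_{xⱼ}| = mᵢⱼ.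
HasExtType : ∀ {n k} → (Fin k → V n) → Subset k →
  ℕ → ℕ → ℕ → ℕ → ℕ → ℕ → ℕ → ℕ → ℕ → ℕ → Set
HasExtType {k = k} s p n₁ n₂ n₃ n₄ m₁₂ m₁₃ m₁₄ m₂₃ m₂₄ m₃₄ =
  ∣ ∁ p ∣ ≡ 4 ×
  Σ (Fin k) λ d₁ → Σ (Fin k) λ d₂ → Σ (Fin k) λ d₃ → Σ (Fin k) λ d₄ →
  d₁ ∈ ∁ p × d₂ ∈ ∁ p × d₃ ∈ ∁ p × d₄ ∈ ∁ p ×
  d₁ ≢ d₂ × d₁ ≢ d₃ × d₁ ≢ d₄ × d₂ ≢ d₃ × d₂ ≢ d₄ × d₃ ≢ d₄ ×
  Σ (Subset k) λ t₁ → Σ (Subset k) λ t₂ → Σ (Subset k) λ t₃ → Σ (Subset k) λ t₄ →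
  t₁ ⊆ p × t₂ ⊆ p × t₃ ⊆ p × t₄ ⊆ p ×
  sumOver s t₁ ≡ s d₁ × sumOver s t₂ ≡ s d₂ ×
  sumOver s t₃ ≡ s d₃ × sumOver s t₄ ≡ s d₄ ×
  ∣ t₁ ∣ ≡ n₁ × ∣ t₂ ∣ ≡ n₂ × ∣ t₃ ∣ ≡ n₃ × ∣ t₄ ∣ ≡ n₄ ×
  ∣ t₁ ∩ t₂ ∣ ≡ m₁₂ × ∣ t₁ ∩ t₃ ∣ ≡ m₁₃ × ∣ t₁ ∩ t₄ ∣ ≡ m₁₄ ×
  ∣ t₂ ∩ t₃ ∣ ≡ m₂₃ × ∣ t₂ ∩ t₄ ∣ ≡ m₂₄ × ∣ t₃ ∩ t₄ ∣ ≡ m₃₄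

-- Fix a basis of the cap, with dependent points x₁,…,x₄ and fundamental circuits Cᵢ = B_{xᵢ} ∪ {xᵢ}.
-- Recording which circuits contain a point x gives a column c(x) ∈ Z₂⁴ with c(xᵢ) = eᵢ, and the affine
-- dependencies of the cap are exactly the sets {x | a · c(x) = 1}. In a cap no dependency has 2 or 4
-- elements, so every nonzero a is met by at least 6 of the 12 columns, and double counting shows that
-- the columns are nonzero and pairwise distinct. What remains is finite: the columns form one of 13
-- configurations, and for each a decision procedure checks an explicit exchange of dependent points —
-- new columns vᵢ with dual functionals aᵢ, so that B_{x′ᵢ} = {x | aᵢ · c(x) = 1} ∖ {x′ᵢ} — realising
-- the extended type 5-5-5-5-(2,3,3,3,3,3).
module Submission where

open import Defs
open import Algebra.Bundles using (CommutativeRing)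
open import Data.Bool using (Bool; true; false; not; _∧_; _xor_; if_then_else_; T)
open import Data.Bool.Properties
  renaming (_≟_ to _≟𝔹_) using (T-∧; not-involutive; ¬-not; xor-assoc; xor-comm; xor-identityˡ; xor-identityʳ; xor-same; xor-∧-commutativeRing; ∧-identityʳ; ∧-zeroʳ)
open import Data.Empty using (⊥-elim) renaming (⊥ to ∅)
open import Data.Fin using (Fin; zero; suc; #_) renaming (_≟_ to _≟ᶠ_)
open import Data.Fin.Properties using (all?) renaming (any? to anyFin?)
open import Data.Fin.Subset using (Subset; ⁅_⁆; _∈_; _∉_; _⊆_; _-_; ∣_∣; ⊤; ∁; _∩_)
open import Data.Fin.Subset.Properties using (∩-zeroʳ; ∈⊤; x∈∁p⇒x∉p; x∉p⇒x∈∁p; ∣∁p∣≡n∸∣p∣; ∉⊥; x∈⁅x⁆; x∈⁅y⁆⇒x≡y; p─⊥≡p; p─q⊆p; x∈p∧x≢y⇒x∈p-y; _∈?_)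
open import Data.Nat using (ℕ; zero; suc; _+_; _*_; _∸_; _≤_; _%_; _/_; _≡ᵇ_; _≤ᵇ_; _≤?_; s≤s; z≤n)
open import Data.Nat.DivMod using (%-distribˡ-+)
open import Data.Nat.Properties
  using (suc-injective; +-identityʳ; *-identityˡ; *-zeroʳ; *-comm; *-assoc; *-distribˡ-+; +-mono-≤; *-monoʳ-≤; +-commutativeSemigroup;
         ≤-antisym; ≤-trans; ≤-reflexive; ≤-pred; m≤n+m; n≤1+n; +-monoˡ-≤; +-cancelˡ-≤; *-distribʳ-+; *-cancelˡ-<; +-cancelʳ-≡) renaming (_≟_ to _≟ℕ_)
open import Data.Unit using (tt)
open import Data.List using (List; []; _∷_)
import Data.List as List
import Data.Vec as Vec
open import Data.List.Relation.Unary.Any using (Any; any?; satisfied)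
open import Data.Maybe using (Maybe; just; nothing)
open import Data.Maybe.Relation.Unary.All using (just; nothing) renaming (All to AllMaybe)
open import Data.Product using (Σ; ∃; _×_; _,_; proj₁; proj₂)
open import Data.Vec using (Vec; []; _∷_; lookup; tabulate; here; there)
open import Data.Vec.Properties
  using (zipWith-assoc; zipWith-identityˡ; zipWith-identityʳ; lookup-zipWith; lookup-replicate;
         []=⇒lookup; lookup⇒[]=; ≡-dec; lookup-map; lookup∘tabulate; tabulate∘lookup; tabulate-cong)
open import Function using (_∘_; _⇔_; mk⇔; Equivalence)
open import Function.Definitions using (Injective)
open import Relation.Binary.PropositionalEquality
open import Relation.Nullary using (¬_; ¬?; Dec; does; yes; no; contradiction)
open import Relation.Nullary.Decidable using (map′; _×-dec_; _→-dec_; toWitness; dec-true; dec-false)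
open import Relation.Unary using (Decidable)

open import Algebra.Properties.CommutativeSemigroup
  (CommutativeRing.+-commutativeSemigroup xor-∧-commutativeRing) using () renaming (interchange to xor-interchange)
open import Algebra.Properties.CommutativeSemigroup +-commutativeSemigroup using () renaming (interchange to +-interchange)

private
  variable
    n k m m′ : ℕ

⊕-assoc : (x y z : V n) → (x ⊕ y) ⊕ z ≡ x ⊕ (y ⊕ z)
⊕-assoc = zipWith-assoc xor-assoc

⊕-identityˡ : (x : V n) → 𝟎 ⊕ x ≡ x
⊕-identityˡ = zipWith-identityˡ xor-identityˡ

⊕-identityʳ : (x : V n) → x ⊕ 𝟎 ≡ x
⊕-identityʳ = zipWith-identityʳ xor-identityʳ

⊕-self : (x : V n) → x ⊕ x ≡ 𝟎
⊕-self [] = refl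
⊕-self (a ∷ x) = cong₂ _∷_ (xor-same a) (⊕-self x)

⊕-interchange : (w x y z : V n) → (w ⊕ x) ⊕ (y ⊕ z) ≡ (w ⊕ y) ⊕ (x ⊕ z)
⊕-interchange [] [] [] [] = refl
⊕-interchange (a ∷ w) (b ∷ x) (c ∷ y) (d ∷ z) = cong₂ _∷_ (xor-interchange a b c d) (⊕-interchange w x y z)

⊕≡𝟎⇒≡ : (x y : V n) → x ⊕ y ≡ 𝟎 → x ≡ y
⊕≡𝟎⇒≡ x y x⊕y≡𝟎 = begin
  x             ≡⟨ ⊕-identityʳ x ⟨
  x ⊕ 𝟎         ≡⟨ cong (x ⊕_) (⊕-self y) ⟨
  x ⊕ (y ⊕ y)   ≡⟨ ⊕-assoc x y y ⟨
  (x ⊕ y) ⊕ y   ≡⟨ cong (_⊕ y) x⊕y≡𝟎 ⟩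
  𝟎 ⊕ y         ≡⟨ ⊕-identityˡ y ⟩
  y             ∎
  where open ≡-Reasoning

lookup-⊕ : (x y : V n) (i : Fin n) → lookup (x ⊕ y) i ≡ lookup x i xor lookup y i
lookup-⊕ x y i = lookup-zipWith _xor_ i x y

lookup-𝟎 : (i : Fin n) → lookup 𝟎 i ≡ false
lookup-𝟎 i = lookup-replicate i false

≗⇒≡ : {x y : V n} → (∀ i → lookup x i ≡ lookup y i) → x ≡ y
≗⇒≡ {x = x} {y} eq = trans (sym (tabulate∘lookup x)) (trans (tabulate-cong eq) (tabulate∘lookup y))

∈⇒lookup : {x : Fin k} {u : Subset k} → x ∈ u → lookup u x ≡ true
∈⇒lookup = []=⇒lookup

lookup⇒∈ : {x : Fin k} {u : Subset k} → lookup u x ≡ true → x ∈ u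
lookup⇒∈ {x = x} {u} = lookup⇒[]= x u

∉⇒lookup : {x : Fin k} {u : Subset k} → x ∉ u → lookup u x ≡ false
∉⇒lookup {x = x} {u} x∉u with lookup u x in ux
... | true = ⊥-elim (x∉u (lookup⇒∈ ux))
... | false = refl

does⇒ : {A : Set} (a? : Dec A) → does a? ≡ true → A
does⇒ (yes a) _ = a

lookup-if : (b : Bool) (x : V n) (i : Fin n) → lookup (if b then x else 𝟎) i ≡ b ∧ lookup x i
lookup-if true x i = refl
lookup-if false x i = lookup-𝟎 i

lookup-⁅⁆-≢ : {x y : Fin k} → x ≢ y → lookup ⁅ x ⁆ y ≡ false
lookup-⁅⁆-≢ x≢y = ∉⇒lookup (x≢y ∘ sym ∘ x∈⁅y⁆⇒x≡y _)

lookup-⁅⁆ : (j i : Fin m) → lookup ⁅ j ⁆ i ≡ does (i ≟ᶠ j)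
lookup-⁅⁆ j i with i ≟ᶠ j
... | yes refl = ∈⇒lookup (x∈⁅x⁆ i)
... | no i≢j = lookup-⁅⁆-≢ (i≢j ∘ sym)

lookup-⊕⁅⁆ : (u : Subset k) {x y : Fin k} → x ≢ y → lookup (u ⊕ ⁅ x ⁆) y ≡ lookup u y
lookup-⊕⁅⁆ u {x} {y} x≢y = trans (lookup-⊕ u ⁅ x ⁆ y) (trans (cong (lookup u y xor_) (lookup-⁅⁆-≢ x≢y)) (xor-identityʳ _))

lookup-⊕⁅⁆-self : (u : Subset k) (x : Fin k) → lookup (u ⊕ ⁅ x ⁆) x ≡ not (lookup u x)
lookup-⊕⁅⁆-self u x = trans (lookup-⊕ u ⁅ x ⁆ x) (trans (cong (lookup u x xor_) (∈⇒lookup (x∈⁅x⁆ x))) (xor-comm _ true))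

lookup-⁅⁆-injective : {f : Fin m → Fin k} → Injective _≡_ _≡_ f → ∀ i j → lookup ⁅ f i ⁆ (f j) ≡ lookup ⁅ j ⁆ i
lookup-⁅⁆-injective {f = f} f-inj i j with j ≟ᶠ i
... | yes refl = trans (∈⇒lookup (x∈⁅x⁆ (f i))) (sym (∈⇒lookup (x∈⁅x⁆ i)))
... | no j≢i = trans (lookup-⁅⁆-≢ (j≢i ∘ sym ∘ f-inj)) (sym (lookup-⁅⁆-≢ j≢i))

if-xor : (a b : Bool) (x : V n) → (if a xor b then x else 𝟎) ≡ (if a then x else 𝟎) ⊕ (if b then x else 𝟎)
if-xor true true x = sym (⊕-self x)
if-xor true false x = sym (⊕-identityʳ x)
if-xor false b x = sym (⊕-identityˡ _)

sumOver-⊕ : (s : Fin k → V n) (u v : Subset k) → sumOver s (u ⊕ v) ≡ sumOver s u ⊕ sumOver s v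
sumOver-⊕ s [] [] = sym (⊕-identityˡ 𝟎)
sumOver-⊕ s (a ∷ u) (b ∷ v) = begin
  (if a xor b then s zero else 𝟎) ⊕ sumOver (s ∘ suc) (u ⊕ v)
    ≡⟨ cong₂ _⊕_ (if-xor a b (s zero)) (sumOver-⊕ (s ∘ suc) u v) ⟩
  ((if a then s zero else 𝟎) ⊕ (if b then s zero else 𝟎)) ⊕ (sumOver (s ∘ suc) u ⊕ sumOver (s ∘ suc) v)
    ≡⟨ ⊕-interchange _ _ _ _ ⟩
  sumOver s (a ∷ u) ⊕ sumOver s (b ∷ v) ∎
  where open ≡-Reasoning

sumOver-𝟎 : (s : Fin k → V n) → sumOver s 𝟎 ≡ 𝟎
sumOver-𝟎 {k = zero} s = refl
sumOver-𝟎 {k = suc k} s = trans (⊕-identityˡ _) (sumOver-𝟎 (s ∘ suc))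

sumOver-⁅⁆ : (s : Fin k → V n) (x : Fin k) → sumOver s ⁅ x ⁆ ≡ s x
sumOver-⁅⁆ s zero = trans (cong (s zero ⊕_) (sumOver-𝟎 (s ∘ suc))) (⊕-identityʳ (s zero))
sumOver-⁅⁆ s (suc x) = trans (⊕-identityˡ _) (sumOver-⁅⁆ (s ∘ suc) x)

sumOver-cong : {g h : Fin m → V n} → (∀ i → g i ≡ h i) → (a : Subset m) → sumOver g a ≡ sumOver h a
sumOver-cong eq [] = refl
sumOver-cong eq (b ∷ a) = cong₂ _⊕_ (cong (λ x → if b then x else 𝟎) (eq zero)) (sumOver-cong (eq ∘ suc) a)

sumOver-if : (s : Fin k → V n) (b : Bool) (u : Subset k) → sumOver s (if b then u else 𝟎) ≡ (if b then sumOver s u else 𝟎)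
sumOver-if s true u = refl
sumOver-if s false u = sumOver-𝟎 s

sumOver-sumOver : (s : Fin k → V n) (g : Fin m → Subset k) (a : Subset m) →
                  sumOver s (sumOver g a) ≡ sumOver (sumOver s ∘ g) a
sumOver-sumOver s g [] = sumOver-𝟎 s
sumOver-sumOver s g (b ∷ a) = begin
  sumOver s ((if b then g zero else 𝟎) ⊕ sumOver (g ∘ suc) a)
    ≡⟨ sumOver-⊕ s _ _ ⟩
  sumOver s (if b then g zero else 𝟎) ⊕ sumOver s (sumOver (g ∘ suc) a)
    ≡⟨ cong₂ _⊕_ (sumOver-if s b (g zero)) (sumOver-sumOver s (g ∘ suc) a) ⟩
  sumOver (sumOver s ∘ g) (b ∷ a) ∎
  where open ≡-Reasoning

sumOver-closed : (P : V n → Set) → P 𝟎 → (∀ {x y} → P x → P y → P (x ⊕ y)) →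
                 {g : Fin m → V n} → (∀ i → P (g i)) → (a : Subset m) → P (sumOver g a)
sumOver-closed P P𝟎 P⊕ Pg [] = P𝟎
sumOver-closed P P𝟎 P⊕ Pg (true ∷ a) = P⊕ (Pg zero) (sumOver-closed P P𝟎 P⊕ (Pg ∘ suc) a)
sumOver-closed P P𝟎 P⊕ Pg (false ∷ a) = P⊕ P𝟎 (sumOver-closed P P𝟎 P⊕ (Pg ∘ suc) a)

parity : Subset k → Bool
parity [] = false
parity (b ∷ u) = b xor parity u

parity-⊕ : (u v : Subset k) → parity (u ⊕ v) ≡ parity u xor parity v
parity-⊕ [] [] = refl
parity-⊕ (a ∷ u) (b ∷ v) = trans (cong ((a xor b) xor_) (parity-⊕ u v)) (xor-interchange a b (parity u) (parity v))

parity-𝟎 : parity (𝟎 {k}) ≡ false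
parity-𝟎 {zero} = refl
parity-𝟎 {suc k} = parity-𝟎 {k}

parity-⁅⁆ : (x : Fin k) → parity ⁅ x ⁆ ≡ true
parity-⁅⁆ {suc k} zero = cong not (parity-𝟎 {k})
parity-⁅⁆ (suc x) = parity-⁅⁆ x

∣∣%2≡parity : (u : Subset k) → ∣ u ∣ % 2 ≡ (if parity u then 1 else 0)
∣∣%2≡parity [] = refl
∣∣%2≡parity (false ∷ u) = ∣∣%2≡parity u
∣∣%2≡parity (true ∷ u) = begin
  suc ∣ u ∣ % 2                          ≡⟨ %-distribˡ-+ 1 ∣ u ∣ 2 ⟩
  suc (∣ u ∣ % 2) % 2                    ≡⟨ cong (λ r → suc r % 2) (∣∣%2≡parity u) ⟩
  suc (if parity u then 1 else 0) % 2    ≡⟨ flip (parity u) ⟩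
  (if not (parity u) then 1 else 0)      ∎
  where
  open ≡-Reasoning
  flip : ∀ b → suc (if b then 1 else 0) % 2 ≡ (if not b then 1 else 0)
  flip true = refl
  flip false = refl

odd⇔parity : (u : Subset k) → Odd ∣ u ∣ ⇔ parity u ≡ true
odd⇔parity u = mk⇔ (to (parity u) (∣∣%2≡parity u)) (λ p → trans (∣∣%2≡parity u) (cong (λ b → if b then 1 else 0) p))
  where
  to : ∀ b → ∣ u ∣ % 2 ≡ (if b then 1 else 0) → Odd ∣ u ∣ → b ≡ true
  to true _ _ = refl
  to false eq odd with () ← trans (sym odd) eq

_·_ : Subset m → Subset m → Bool
a · v = parity (a ∩ v)

·-⁅⁆ : (a : Subset m) (j : Fin m) → a · ⁅ j ⁆ ≡ lookup a j
·-⁅⁆ {suc m} (b ∷ a) zero = begin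
  (b ∧ true) xor parity (a ∩ 𝟎)  ≡⟨ cong₂ _xor_ (∧-identityʳ b) (trans (cong parity (∩-zeroʳ a)) (parity-𝟎 {m})) ⟩
  b xor false                    ≡⟨ xor-identityʳ b ⟩
  b                              ∎
  where open ≡-Reasoning
·-⁅⁆ (b ∷ a) (suc j) = cong₂ _xor_ (∧-zeroʳ b) (·-⁅⁆ a j)

column : (Fin m → Subset k) → Fin k → Subset m
column g x = tabulate (λ i → lookup (g i) x)

lookup-sumOver : (g : Fin m → Subset k) (a : Subset m) (x : Fin k) → lookup (sumOver g a) x ≡ a · column g x
lookup-sumOver g [] x = lookup-𝟎 x
lookup-sumOver g (b ∷ a) x = begin
  lookup ((if b then g zero else 𝟎) ⊕ sumOver (g ∘ suc) a) x
    ≡⟨ lookup-⊕ (if b then g zero else 𝟎) (sumOver (g ∘ suc) a) x ⟩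
  lookup (if b then g zero else 𝟎) x xor lookup (sumOver (g ∘ suc) a) x
    ≡⟨ cong₂ _xor_ (lookup-if b (g zero) x) (lookup-sumOver (g ∘ suc) a x) ⟩
  (b ∷ a) · column g x ∎
  where open ≡-Reasoning

x∉p-x : (u : Subset k) (x : Fin k) → x ∉ u - x
x∉p-x (b ∷ u) zero ()
x∉p-x (b ∷ u) (suc x) (there x∈u-x) = x∉p-x u x x∈u-x

x∈p-y⇒x≢y : {x y : Fin k} {u : Subset k} → x ∈ u - y → x ≢ y
x∈p-y⇒x≢y {u = u} x∈u-y refl = x∉p-x u _ x∈u-y

x∈p⇒p≡⁅x⁆⊕p-x : {x : Fin k} {u : Subset k} → x ∈ u → u ≡ ⁅ x ⁆ ⊕ (u - x)
x∈p⇒p≡⁅x⁆⊕p-x {u = true ∷ u} here = cong (true ∷_) (sym (trans (⊕-identityˡ _) (p─⊥≡p u)))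
x∈p⇒p≡⁅x⁆⊕p-x {u = b ∷ u} (there x∈u) = cong (b ∷_) (x∈p⇒p≡⁅x⁆⊕p-x x∈u)

x∈p⇒∣p∣≡1+∣p-x∣ : {x : Fin k} {u : Subset k} → x ∈ u → ∣ u ∣ ≡ suc ∣ u - x ∣
x∈p⇒∣p∣≡1+∣p-x∣ {u = true ∷ u} here = cong (suc ∘ ∣_∣) (sym (p─⊥≡p u))
x∈p⇒∣p∣≡1+∣p-x∣ {u = true ∷ u} (there x∈u) = cong suc (x∈p⇒∣p∣≡1+∣p-x∣ x∈u)
x∈p⇒∣p∣≡1+∣p-x∣ {u = false ∷ u} (there x∈u) = x∈p⇒∣p∣≡1+∣p-x∣ x∈u

∣p∣≡0⇒p≡𝟎 : (u : Subset k) → ∣ u ∣ ≡ 0 → u ≡ 𝟎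
∣p∣≡0⇒p≡𝟎 [] _ = refl
∣p∣≡0⇒p≡𝟎 (false ∷ u) ∣u∣≡0 = cong (false ∷_) (∣p∣≡0⇒p≡𝟎 u ∣u∣≡0)

∣p∣≡1+m⇒nonempty : (u : Subset k) → ∣ u ∣ ≡ suc m → ∃ (_∈ u)
∣p∣≡1+m⇒nonempty (true ∷ u) _ = zero , here
∣p∣≡1+m⇒nonempty (false ∷ u) ∣u∣≡1+m =
  let x , x∈u = ∣p∣≡1+m⇒nonempty u ∣u∣≡1+m in suc x , there x∈u

∈⇒1≤∣∣ : {x : Fin k} {u : Subset k} → x ∈ u → 1 ≤ ∣ u ∣
∈⇒1≤∣∣ x∈u = subst (1 ≤_) (sym (x∈p⇒∣p∣≡1+∣p-x∣ x∈u)) (s≤s z≤n)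

record Enumeration (u : Subset k) (m : ℕ) : Set where
  field
    element       : Fin m → Fin k
    injective     : Injective _≡_ _≡_ element
    element∈      : ∀ i → element i ∈ u
    surjective    : ∀ {x} → x ∈ u → ∃ λ i → element i ≡ x
    decomposition : u ≡ sumOver (⁅_⁆ ∘ element) ⊤

enumeration-∷ : {x : Fin k} {u : Subset k} → x ∈ u → Enumeration (u - x) m → Enumeration u (suc m)
enumeration-∷ {k} {m} {x} {u} x∈u E = record
  { element = element ; injective = injective ; element∈ = element∈
  ; surjective = surjective ; decomposition = trans (x∈p⇒p≡⁅x⁆⊕p-x x∈u) (cong (⁅ x ⁆ ⊕_) E.decomposition) }
  where
  module E = Enumeration E

  element : Fin (suc m) → Fin k
  element zero = x
  element (suc i) = E.element i

  injective : Injective _≡_ _≡_ element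
  injective {zero} {zero} _ = refl
  injective {zero} {suc j} eq = ⊥-elim (x∈p-y⇒x≢y (E.element∈ j) (sym eq))
  injective {suc i} {zero} eq = ⊥-elim (x∈p-y⇒x≢y (E.element∈ i) eq)
  injective {suc i} {suc j} eq = cong suc (E.injective eq)

  element∈ : ∀ i → element i ∈ u
  element∈ zero = x∈u
  element∈ (suc i) = p─q⊆p u ⁅ x ⁆ (E.element∈ i)

  surjective : ∀ {y} → y ∈ u → ∃ λ i → element i ≡ y
  surjective {y} y∈u with y ≟ᶠ x
  ... | yes refl = zero , refl
  ... | no y≢x = let i , eq = E.surjective (x∈p∧x≢y⇒x∈p-y y∈u y≢x) in suc i , eq

enumerate : (u : Subset k) → ∣ u ∣ ≡ m → Enumeration u m
enumerate {m = zero} u ∣u∣≡0 = record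
  { element = λ () ; injective = λ {i} → ⊥-elim (no-index i) ; element∈ = λ ()
  ; surjective = λ x∈u → ⊥-elim (∉⊥ (subst (_ ∈_) (∣p∣≡0⇒p≡𝟎 u ∣u∣≡0) x∈u))
  ; decomposition = ∣p∣≡0⇒p≡𝟎 u ∣u∣≡0 }
  where
  no-index : Fin 0 → ∅
  no-index ()
enumerate {m = suc m} u ∣u∣≡1+m =
  let x , x∈u = ∣p∣≡1+m⇒nonempty u ∣u∣≡1+m
  in enumeration-∷ x∈u (enumerate (u - x) (suc-injective (trans (sym (x∈p⇒∣p∣≡1+∣p-x∣ x∈u)) ∣u∣≡1+m)))

sumOver-enumeration : {u : Subset k} (E : Enumeration u m) (s : Fin k → V n) →
                      sumOver s u ≡ sumOver (s ∘ Enumeration.element E) ⊤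
sumOver-enumeration {u = u} E s = begin
  sumOver s u                             ≡⟨ cong (sumOver s) decomposition ⟩
  sumOver s (sumOver (⁅_⁆ ∘ element) ⊤)   ≡⟨ sumOver-sumOver s (⁅_⁆ ∘ element) ⊤ ⟩
  sumOver (sumOver s ∘ ⁅_⁆ ∘ element) ⊤   ≡⟨ sumOver-cong (sumOver-⁅⁆ s ∘ element) ⊤ ⟩
  sumOver (s ∘ element) ⊤                 ∎
  where
  open ≡-Reasoning
  open Enumeration E

∣p∣≡1⇒p≡⁅x⁆ : (u : Subset k) → ∣ u ∣ ≡ 1 → ∃ λ x → u ≡ ⁅ x ⁆
∣p∣≡1⇒p≡⁅x⁆ u ∣u∣≡1 = element zero , trans decomposition (⊕-identityʳ _)
  where open Enumeration (enumerate u ∣u∣≡1)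

-- Affine dependencies

IsDependency : (Fin k → V n) → Subset k → Set
IsDependency s u = sumOver s u ≡ 𝟎 × parity u ≡ false

module _ (s : Fin k → V n) where

  dependency-𝟎 : IsDependency s 𝟎
  dependency-𝟎 = sumOver-𝟎 s , parity-𝟎 {k}

  dependency-⊕ : ∀ {u v} → IsDependency s u → IsDependency s v → IsDependency s (u ⊕ v)
  dependency-⊕ {u} {v} (Σu , πu) (Σv , πv) =
    trans (sumOver-⊕ s u v) (trans (cong₂ _⊕_ Σu Σv) (⊕-identityˡ 𝟎)) ,
    trans (parity-⊕ u v) (cong₂ _xor_ πu πv)

  dependency-sumOver : {g : Fin m → Subset k} → (∀ i → IsDependency s (g i)) → ∀ a → IsDependency s (sumOver g a)
  dependency-sumOver = sumOver-closed (IsDependency s) dependency-𝟎 dependency-⊕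

  representation-⊕⁅⁆ : ∀ {t x} → sumOver s t ≡ s x → parity t ≡ true → IsDependency s (t ⊕ ⁅ x ⁆)
  representation-⊕⁅⁆ {t} {x} Σt πt =
    trans (sumOver-⊕ s t ⁅ x ⁆) (trans (cong₂ _⊕_ Σt (sumOver-⁅⁆ s x)) (⊕-self (s x))) ,
    trans (parity-⊕ t ⁅ x ⁆) (cong₂ _xor_ πt (parity-⁅⁆ x))

  dependency-⊕⁅⁆ : ∀ {u} x → IsDependency s u → sumOver s (u ⊕ ⁅ x ⁆) ≡ s x × parity (u ⊕ ⁅ x ⁆) ≡ true
  dependency-⊕⁅⁆ {u} x (Σu , πu) =
    trans (sumOver-⊕ s u ⁅ x ⁆) (trans (cong₂ _⊕_ Σu (sumOver-⁅⁆ s x)) (⊕-identityˡ (s x))) ,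
    trans (parity-⊕ u ⁅ x ⁆) (cong₂ _xor_ πu (parity-⁅⁆ x))

  independent⇒dependency≡𝟎 : ∀ {p u} → AffIndep s p → IsDependency s u → u ⊆ p → u ≡ 𝟎
  independent⇒dependency≡𝟎 {p} {u} indep dep u⊆p = ≗⇒≡ vanishes
    where
    vanishes : ∀ x → lookup u x ≡ lookup 𝟎 x
    vanishes x with lookup u x in ux
    ... | false = sym (lookup-𝟎 x)
    ... | true = ⊥-elim (indep x (u⊆p (lookup⇒∈ ux)) (u ⊕ ⁅ x ⁆ , inside , odd , sum))
      where
      sum = proj₁ (dependency-⊕⁅⁆ x dep)
      odd = Equivalence.from (odd⇔parity (u ⊕ ⁅ x ⁆)) (proj₂ (dependency-⊕⁅⁆ x dep))
      inside : u ⊕ ⁅ x ⁆ ⊆ p - x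
      inside {y} y∈ with y ≟ᶠ x
      ... | yes refl with () ← trans (sym (∈⇒lookup y∈)) (trans (lookup-⊕⁅⁆-self u x) (cong not ux))
      ... | no y≢x = x∈p∧x≢y⇒x∈p-y (u⊆p (lookup⇒∈ (trans (sym (lookup-⊕⁅⁆ u (y≢x ∘ sym))) (∈⇒lookup y∈)))) y≢x

  dependency≡𝟎⇒independent : ∀ {p} → (∀ {u} → IsDependency s u → u ⊆ p → u ≡ 𝟎) → AffIndep s p
  dependency≡𝟎⇒independent {p} trivial x x∈p (t , t⊆p-x , odd , sum) = contradiction (begin
      true                        ≡⟨ cong not (∉⇒lookup (x∉p-x p x ∘ t⊆p-x)) ⟨
      not (lookup t x)            ≡⟨ lookup-⊕⁅⁆-self t x ⟨
      lookup (t ⊕ ⁅ x ⁆) x        ≡⟨ cong (λ w → lookup w x) (trivial dep t⊕x⊆p) ⟩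
      lookup 𝟎 x                  ≡⟨ lookup-𝟎 x ⟩
      false                       ∎) λ ()
    where
    open ≡-Reasoning
    dep = representation-⊕⁅⁆ sum (Equivalence.to (odd⇔parity t) odd)
    t⊕x⊆p : t ⊕ ⁅ x ⁆ ⊆ p
    t⊕x⊆p {y} y∈ with y ≟ᶠ x
    ... | yes refl = x∈p
    ... | no y≢x = p─q⊆p p ⁅ x ⁆ (t⊆p-x (lookup⇒∈ (trans (sym (lookup-⊕⁅⁆ t (y≢x ∘ sym))) (∈⇒lookup y∈))))

  cap-dependency-size : IsKCap k s → ∀ {u x} → IsDependency s u → x ∈ u → 6 ≤ ∣ u ∣
  cap-dependency-size (inj , cap) {u} {x} (Σu , πu) x∈u = bound ∣ u ∣ refl
    where
    even : ∀ {m} → ∣ u ∣ ≡ m → ¬ Odd m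
    even ∣u∣≡m odd with () ← trans (sym (Equivalence.to (odd⇔parity u) (trans (cong (_% 2) ∣u∣≡m) odd))) πu

    no-pair : ¬ Enumeration u 2
    no-pair E = contradiction (injective (inj (⊕≡𝟎⇒≡ _ _ (trans (cong (s (element zero) ⊕_) (sym (⊕-identityʳ _)))
                                                     (trans (sym (sumOver-enumeration E s)) Σu))))) λ ()
      where open Enumeration E

    no-quad : ¬ Enumeration u 4
    no-quad E = cap _ _ _ _ (distinct λ ()) (distinct λ ()) (distinct λ ()) (distinct λ ()) (distinct λ ()) (distinct λ ())
      (trans (⊕-assoc _ _ _) (trans (cong (λ w → s (element zero) ⊕ (s (element (suc zero)) ⊕ (s (element (suc (suc zero))) ⊕ w))) (sym (⊕-identityʳ _)))
        (trans (sym (sumOver-enumeration E s)) Σu)))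
      where
      open Enumeration E
      distinct : ∀ {i j} → i ≢ j → element i ≢ element j
      distinct i≢j = i≢j ∘ injective

    bound : ∀ m → ∣ u ∣ ≡ m → 6 ≤ m
    bound 0 ∣u∣≡0 = ⊥-elim (∉⊥ (subst (x ∈_) (∣p∣≡0⇒p≡𝟎 u ∣u∣≡0) x∈u))
    bound 1 ∣u∣≡1 = ⊥-elim (even ∣u∣≡1 refl)
    bound 2 ∣u∣≡2 = ⊥-elim (no-pair (enumerate u ∣u∣≡2))
    bound 3 ∣u∣≡3 = ⊥-elim (even ∣u∣≡3 refl)
    bound 4 ∣u∣≡4 = ⊥-elim (no-quad (enumerate u ∣u∣≡4))
    bound 5 ∣u∣≡5 = ⊥-elim (even ∣u∣≡5 refl)
    bound (suc (suc (suc (suc (suc (suc _)))))) _ = s≤s (s≤s (s≤s (s≤s (s≤s (s≤s z≤n)))))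

  dependency-⊕-invariant : ∀ {t w} → IsDependency s w → sumOver s (t ⊕ w) ≡ sumOver s t × parity (t ⊕ w) ≡ parity t
  dependency-⊕-invariant {t} {w} (Σw , πw) =
    trans (sumOver-⊕ s t w) (trans (cong (sumOver s t ⊕_) Σw) (⊕-identityʳ _)) ,
    trans (parity-⊕ t w) (trans (cong (parity t xor_) πw) (xor-identityʳ _))

-- Fundamental circuits

restrict : Subset k → (Fin m → Fin k) → Subset m
restrict u q = tabulate (lookup u ∘ q)

-- point j is the dependent point x_j, circuit j is B_{x_j} ∪ {x_j} and representation j is B_{x_j}.
record FundamentalCircuits (s : Fin k → V n) (p : Subset k) (m : ℕ) : Set where
  field
    point        : Fin m → Fin k
    circuit      : Fin m → Subset k
    dependency   : ∀ i → IsDependency s (circuit i)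
    column-point : ∀ j → column circuit (point j) ≡ ⁅ j ⁆
    point∉       : ∀ j → point j ∉ p
    ∉⇒point      : ∀ {x} → x ∉ p → ∃ λ j → point j ≡ x

  representation : Fin m → Subset k
  representation i = circuit i ⊕ ⁅ point i ⁆

module _ {s : Fin k → V n} {p : Subset k} (F : FundamentalCircuits s p m) where
  open FundamentalCircuits F

  lookup-circuit-point : ∀ i j → lookup (circuit i) (point j) ≡ lookup ⁅ j ⁆ i
  lookup-circuit-point i j = trans (sym (lookup∘tabulate (λ i → lookup (circuit i) (point j)) i)) (cong (λ v → lookup v i) (column-point j))

  point-injective : Injective _≡_ _≡_ point
  point-injective {i} {j} eq = x∈⁅y⁆⇒x≡y j (lookup⇒∈ (trans (sym (lookup-circuit-point i j))
                                  (trans (cong (lookup (circuit i)) (sym eq)) (trans (lookup-circuit-point i i) (∈⇒lookup (x∈⁅x⁆ i))))))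

  lookup-sumOver-point : ∀ a j → lookup (sumOver circuit a) (point j) ≡ lookup a j
  lookup-sumOver-point a j = begin
    lookup (sumOver circuit a) (point j)  ≡⟨ lookup-sumOver circuit a (point j) ⟩
    a · column circuit (point j)          ≡⟨ cong (a ·_) (column-point j) ⟩
    a · ⁅ j ⁆                              ≡⟨ ·-⁅⁆ a j ⟩
    lookup a j                            ∎
    where open ≡-Reasoning

  -- Adding the circuits of the dependent points of u clears them from u.
  reduce⊆p : ∀ u → u ⊕ sumOver circuit (restrict u point) ⊆ p
  reduce⊆p u {y} y∈ with y ∈? p
  ... | yes y∈p = y∈p
  ... | no y∉p with j , refl ← ∉⇒point y∉p = contradiction (begin
    true                                                                ≡⟨ ∈⇒lookup y∈ ⟨
    lookup (u ⊕ w) (point j)                                            ≡⟨ lookup-⊕ u w (point j) ⟩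
    lookup u (point j) xor lookup w (point j)                           ≡⟨ cong (lookup u (point j) xor_) (lookup-sumOver-point _ j) ⟩
    lookup u (point j) xor lookup (restrict u point) j                  ≡⟨ cong (lookup u (point j) xor_) (lookup∘tabulate _ j) ⟩
    lookup u (point j) xor lookup u (point j)                           ≡⟨ xor-same (lookup u (point j)) ⟩
    false                                                               ∎) λ ()
    where
    open ≡-Reasoning
    w = sumOver circuit (restrict u point)

  dependency-coordinates : AffIndep s p → ∀ {u} → IsDependency s u → u ≡ sumOver circuit (restrict u point)
  dependency-coordinates indep {u} dep = ⊕≡𝟎⇒≡ _ _ (independent⇒dependency≡𝟎 s indep
    (dependency-⊕ s dep (dependency-sumOver s dependency (restrict u point))) (reduce⊆p u))

  spans : ∀ x → AffComb s ⊤ x → AffComb s p x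
  spans x (t , _ , odd , Σt) = t ⊕ w , reduce⊆p t , odd′ , trans Σt⊕w Σt
    where
    w = sumOver circuit (restrict t point)
    invariant = dependency-⊕-invariant s (dependency-sumOver s dependency (restrict t point))
    Σt⊕w = proj₁ invariant
    odd′ = Equivalence.from (odd⇔parity (t ⊕ w)) (trans (proj₂ invariant) (Equivalence.to (odd⇔parity t) odd))

  fundamentalCircuits⇒basis : AffIndep s p → IsBasis s p
  fundamentalCircuits⇒basis indep = indep , λ x → mk⇔ (λ (t , t⊆p , rest) → t , (λ _ → ∈⊤) , rest) (spans x)

  sumOver-representation : ∀ i → sumOver s (representation i) ≡ s (point i)
  sumOver-representation i = proj₁ (dependency-⊕⁅⁆ s (point i) (dependency i))

  representation⊆p : ∀ i → representation i ⊆ p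
  representation⊆p i {y} y∈ with y ∈? p
  ... | yes y∈p = y∈p
  ... | no y∉p with j , refl ← ∉⇒point y∉p with j ≟ᶠ i
  ...   | yes refl = contradiction (trans (sym (∈⇒lookup y∈)) (trans (lookup-⊕⁅⁆-self (circuit i) (point i))
                        (cong not (trans (lookup-circuit-point i i) (∈⇒lookup (x∈⁅x⁆ i)))))) λ ()
  ...   | no j≢i = contradiction (trans (sym (∈⇒lookup y∈)) (trans (lookup-⊕⁅⁆ (circuit i) (j≢i ∘ sym ∘ point-injective))
                        (trans (lookup-circuit-point i j) (lookup-⁅⁆-≢ j≢i)))) λ ()

basis⇒fundamentalCircuits : {s : Fin k → V n} {p : Subset k} → IsBasis s p → ∣ ∁ p ∣ ≡ m → FundamentalCircuits s p m
basis⇒fundamentalCircuits {k} {n} {m} {s} {p} (_ , span) ∣∁p∣≡m = record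
  { point = point ; circuit = circuit ; dependency = dependency ; column-point = column-point
  ; point∉ = point∉ ; ∉⇒point = surjective ∘ x∉p⇒x∈∁p }
  where
  open Enumeration (enumerate (∁ p) ∣∁p∣≡m) renaming (element to point)

  point∉ : ∀ j → point j ∉ p
  point∉ = x∈∁p⇒x∉p ∘ element∈

  represented : ∀ j → AffComb s p (s (point j))
  represented j = Equivalence.from (span (s (point j)))
    (⁅ point j ⁆ , (λ _ → ∈⊤) , Equivalence.from (odd⇔parity ⁅ point j ⁆) (parity-⁅⁆ (point j)) , sumOver-⁅⁆ s (point j))

  B : Fin m → Subset k
  B j = proj₁ (represented j)

  circuit : Fin m → Subset k
  circuit j = B j ⊕ ⁅ point j ⁆

  dependency : ∀ j → IsDependency s (circuit j)
  dependency j = representation-⊕⁅⁆ s (proj₂ (proj₂ (proj₂ (represented j))))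
                   (Equivalence.to (odd⇔parity (B j)) (proj₁ (proj₂ (proj₂ (represented j)))))

  column-point : ∀ j → column circuit (point j) ≡ ⁅ j ⁆
  column-point j = ≗⇒≡ λ i → begin
    lookup (column circuit (point j)) i                        ≡⟨ lookup∘tabulate _ i ⟩
    lookup (B i ⊕ ⁅ point i ⁆) (point j)                       ≡⟨ lookup-⊕ (B i) ⁅ point i ⁆ (point j) ⟩
    lookup (B i) (point j) xor lookup ⁅ point i ⁆ (point j)    ≡⟨ cong (_xor _) (∉⇒lookup (point∉ j ∘ proj₁ (proj₂ (represented i)))) ⟩
    lookup ⁅ point i ⁆ (point j)                               ≡⟨ lookup-⁅⁆-injective injective i j ⟩
    lookup ⁅ j ⁆ i                                             ∎
    where open ≡-Reasoning

-- Columns and their multiplicities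

_≟ᵛ_ : (u v : V m) → Dec (u ≡ v)
_≟ᵛ_ = ≡-dec _≟𝔹_

𝟙 : Bool → ℕ
𝟙 true = 1
𝟙 false = 0

∑ : (V m → ℕ) → ℕ
∑ {zero} f = f []
∑ {suc m} f = ∑ (f ∘ (false ∷_)) + ∑ (f ∘ (true ∷_))

∑-cong : {f g : V m → ℕ} → (∀ v → f v ≡ g v) → ∑ f ≡ ∑ g
∑-cong {zero} eq = eq []
∑-cong {suc m} eq = cong₂ _+_ (∑-cong (eq ∘ (false ∷_))) (∑-cong (eq ∘ (true ∷_)))

∑-+ : (f g : V m → ℕ) → ∑ (λ v → f v + g v) ≡ ∑ f + ∑ g
∑-+ {zero} f g = refl
∑-+ {suc m} f g = trans (cong₂ _+_ (∑-+ (f ∘ (false ∷_)) (g ∘ (false ∷_))) (∑-+ (f ∘ (true ∷_)) (g ∘ (true ∷_))))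
                        (+-interchange (∑ (f ∘ (false ∷_))) (∑ (g ∘ (false ∷_))) (∑ (f ∘ (true ∷_))) (∑ (g ∘ (true ∷_))))

∑-*ˡ : (c : ℕ) (f : V m → ℕ) → ∑ (λ v → c * f v) ≡ c * ∑ f
∑-*ˡ {zero} c f = refl
∑-*ˡ {suc m} c f = trans (cong₂ _+_ (∑-*ˡ c (f ∘ (false ∷_))) (∑-*ˡ c (f ∘ (true ∷_)))) (sym (*-distribˡ-+ c _ _))

∑-*ʳ : (f : V m → ℕ) (c : ℕ) → ∑ (λ v → f v * c) ≡ ∑ f * c
∑-*ʳ f c = trans (∑-cong (λ v → *-comm (f v) c)) (trans (∑-*ˡ c f) (*-comm c (∑ f)))

∑-comm : (F : V m → V m′ → ℕ) → ∑ (λ a → ∑ (F a)) ≡ ∑ (λ v → ∑ (λ a → F a v))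
∑-comm {zero} F = refl
∑-comm {suc m} F = begin
  ∑ (λ a → ∑ (F (false ∷ a))) + ∑ (λ a → ∑ (F (true ∷ a)))
    ≡⟨ cong₂ _+_ (∑-comm (F ∘ (false ∷_))) (∑-comm (F ∘ (true ∷_))) ⟩
  ∑ (λ v → ∑ (λ a → F (false ∷ a) v)) + ∑ (λ v → ∑ (λ a → F (true ∷ a) v))
    ≡⟨ ∑-+ (λ v → ∑ (λ a → F (false ∷ a) v)) (λ v → ∑ (λ a → F (true ∷ a) v)) ⟨
  ∑ (λ v → ∑ (λ a → F (false ∷ a) v) + ∑ (λ a → F (true ∷ a) v))
    ∎
  where open ≡-Reasoning

∑-mono-≤ : {f g : V m → ℕ} → (∀ v → f v ≤ g v) → ∑ f ≤ ∑ g
∑-mono-≤ {zero} le = le []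
∑-mono-≤ {suc m} le = +-mono-≤ (∑-mono-≤ (le ∘ (false ∷_))) (∑-mono-≤ (le ∘ (true ∷_)))

∑-delta : (u : V m) (f : V m → ℕ) → ∑ (λ v → 𝟙 (does (u ≟ᵛ v)) * f v) ≡ f u
∑-delta [] f = +-identityʳ (f [])
∑-delta {suc m} (false ∷ u) f = trans (cong₂ _+_ (∑-delta u (f ∘ (false ∷_))) (∑-*ˡ 0 (f ∘ (true ∷_)))) (+-identityʳ _)
∑-delta {suc m} (true ∷ u) f = cong₂ _+_ (∑-*ˡ 0 (f ∘ (false ∷_))) (∑-delta u (f ∘ (true ∷_)))

count : (V m → Bool) → (V m → ℕ) → ℕ
count P N = ∑ λ w → 𝟙 (P w) * N w

count-cong : (P : V m → Bool) {N N′ : V m → ℕ} → (∀ v → N v ≡ N′ v) → count P N ≡ count P N′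
count-cong P eq = ∑-cong (λ w → cong (𝟙 (P w) *_) (eq w))

preimage : (Fin k → V m) → (V m → Bool) → Subset k
preimage c P = tabulate (P ∘ c)

multiplicity : (Fin k → V m) → V m → ℕ
multiplicity c v = ∣ preimage c (λ w → does (w ≟ᵛ v)) ∣

lookup-preimage : (c : Fin k → V m) (P : V m → Bool) (x : Fin k) → lookup (preimage c P) x ≡ P (c x)
lookup-preimage c P = lookup∘tabulate (P ∘ c)

preimage-∩ : (c : Fin k → V m) (P Q : V m → Bool) → preimage c P ∩ preimage c Q ≡ preimage c (λ w → P w ∧ Q w)
preimage-∩ c P Q = ≗⇒≡ λ x → trans (lookup-zipWith _∧_ x (preimage c P) (preimage c Q))
  (trans (cong₂ _∧_ (lookup-preimage c P x) (lookup-preimage c Q x)) (sym (lookup-preimage c (λ w → P w ∧ Q w) x)))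

∁-preimage : (c : Fin k → V m) (P : V m → Bool) → ∁ (preimage c P) ≡ preimage c (not ∘ P)
∁-preimage c P = ≗⇒≡ λ x → trans (lookup-map x not (preimage c P)) (trans (cong not (lookup-preimage c P x)) (sym (lookup-preimage c (not ∘ P) x)))

∣b∷u∣ : (b : Bool) (u : Subset k) → ∣ b ∷ u ∣ ≡ 𝟙 b + ∣ u ∣
∣b∷u∣ true u = refl
∣b∷u∣ false u = refl

∣preimage∣ : (c : Fin k → V m) (P : V m → Bool) → ∣ preimage c P ∣ ≡ count P (multiplicity c)
∣preimage∣ {zero} c P = sym (trans (∑-cong (λ v → *-zeroʳ (𝟙 (P v)))) (∑-*ˡ 0 P′))
  where P′ = 𝟙 ∘ P
∣preimage∣ {suc k} c P = begin
  ∣ P (c zero) ∷ preimage (c ∘ suc) P ∣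
    ≡⟨ ∣b∷u∣ (P (c zero)) (preimage (c ∘ suc) P) ⟩
  𝟙 (P (c zero)) + ∣ preimage (c ∘ suc) P ∣
    ≡⟨ cong₂ _+_ (∑-delta (c zero) (𝟙 ∘ P)) (sym (∣preimage∣ (c ∘ suc) P)) ⟨
  ∑ (λ v → at₀ v * 𝟙 (P v)) + ∑ (λ v → 𝟙 (P v) * multiplicity (c ∘ suc) v)
    ≡⟨ ∑-+ (λ v → at₀ v * 𝟙 (P v)) (λ v → 𝟙 (P v) * multiplicity (c ∘ suc) v) ⟨
  ∑ (λ v → at₀ v * 𝟙 (P v) + 𝟙 (P v) * multiplicity (c ∘ suc) v)
    ≡⟨ ∑-cong split ⟩
  ∑ (λ v → 𝟙 (P v) * multiplicity c v) ∎
  where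
  open ≡-Reasoning
  at₀ : V _ → ℕ
  at₀ v = 𝟙 (does (c zero ≟ᵛ v))
  split : ∀ v → at₀ v * 𝟙 (P v) + 𝟙 (P v) * multiplicity (c ∘ suc) v ≡ 𝟙 (P v) * multiplicity c v
  split v = begin
    at₀ v * 𝟙 (P v) + 𝟙 (P v) * multiplicity (c ∘ suc) v    ≡⟨ cong (_+ 𝟙 (P v) * multiplicity (c ∘ suc) v) (*-comm (at₀ v) (𝟙 (P v))) ⟩
    𝟙 (P v) * at₀ v + 𝟙 (P v) * multiplicity (c ∘ suc) v    ≡⟨ *-distribˡ-+ (𝟙 (P v)) (at₀ v) (multiplicity (c ∘ suc) v) ⟨
    𝟙 (P v) * (at₀ v + multiplicity (c ∘ suc) v)            ≡⟨ cong (𝟙 (P v) *_) (∣b∷u∣ (does (c zero ≟ᵛ v)) (preimage (c ∘ suc) (λ w → does (w ≟ᵛ v)))) ⟨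
    𝟙 (P v) * multiplicity c v                               ∎

∑-multiplicity : (c : Fin k → V m) → ∑ (multiplicity c) ≡ k
∑-multiplicity {k} c = begin
  ∑ (multiplicity c)                      ≡⟨ ∑-cong (λ w → *-identityˡ (multiplicity c w)) ⟨
  count (λ _ → true) (multiplicity c)     ≡⟨ ∣preimage∣ c (λ _ → true) ⟨
  ∣ preimage c (λ _ → true) ∣              ≡⟨ ∣all∣ k ⟩
  k                                       ∎
  where
  open ≡-Reasoning
  ∣all∣ : ∀ k → ∣ tabulate {n = k} (λ _ → true) ∣ ≡ k
  ∣all∣ zero = refl
  ∣all∣ (suc k) = cong suc (∣all∣ k)

unique-preimage : (c : Fin k → V m) {v : V m} → multiplicity c v ≡ 1 → Σ (Fin k) λ x → c x ≡ v × (∀ {y} → c y ≡ v → y ≡ x)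
unique-preimage c {v} N≡1 = element zero , hit , unique
  where
  open Enumeration (enumerate (preimage c (λ w → does (w ≟ᵛ v))) N≡1)
  hit : c (element zero) ≡ v
  hit = does⇒ (c (element zero) ≟ᵛ v) (trans (sym (lookup-preimage c (λ w → does (w ≟ᵛ v)) (element zero))) (∈⇒lookup (element∈ zero)))
  unique : ∀ {y} → c y ≡ v → y ≡ element zero
  unique {y} cy≡v with surjective (lookup⇒∈ (trans (lookup-preimage c (λ w → does (w ≟ᵛ v)) y) (dec-true (c y ≟ᵛ v) cy≡v)))
  ... | zero , eq = sym eq

allᵛ? : {P : V m → Set} → Decidable P → Dec (∀ v → P v)
allᵛ? {zero} P? = map′ (λ { p [] → p }) (λ h → h []) (P? [])
allᵛ? {suc m} P? = map′ (λ { (f , t) (false ∷ v) → f v ; (f , t) (true ∷ v) → t v })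
                        (λ h → h ∘ (false ∷_) , h ∘ (true ∷_))
                        (allᵛ? (P? ∘ (false ∷_)) ×-dec allᵛ? (P? ∘ (true ∷_)))

nonzero : V m → Bool
nonzero v = not (does (𝟎 ≟ᵛ v))

nonzero⇒≢𝟎 : {v : V m} → T (nonzero v) → v ≢ 𝟎
nonzero⇒≢𝟎 {v = v} nz refl rewrite dec-true (𝟎 ≟ᵛ v) refl = nz

weight : (V m → ℕ) → V m → ℕ
weight N a = count (a ·_) N

∑-weight : (f N : V m → ℕ) → ∑ (λ a → f a * weight N a) ≡ ∑ (λ v → ∑ (λ a → f a * 𝟙 (a · v)) * N v)
∑-weight f N = begin
  ∑ (λ a → f a * weight N a)                       ≡⟨ ∑-cong (λ a → ∑-*ˡ (f a) (λ v → 𝟙 (a · v) * N v)) ⟨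
  ∑ (λ a → ∑ (λ v → f a * (𝟙 (a · v) * N v)))      ≡⟨ ∑-comm (λ a v → f a * (𝟙 (a · v) * N v)) ⟩
  ∑ (λ v → ∑ (λ a → f a * (𝟙 (a · v) * N v)))      ≡⟨ ∑-cong (λ v → ∑-cong (λ a → *-assoc (f a) (𝟙 (a · v)) (N v))) ⟨
  ∑ (λ v → ∑ (λ a → f a * 𝟙 (a · v) * N v))        ≡⟨ ∑-cong (λ v → ∑-*ʳ (λ a → f a * 𝟙 (a · v)) (N v)) ⟩
  ∑ (λ v → ∑ (λ a → f a * 𝟙 (a · v)) * N v)        ∎
  where open ≡-Reasoning

module _ {s : Fin k → V n} {p : Subset k} (F : FundamentalCircuits s p m) where
  open FundamentalCircuits F

  ∣sumOver-circuit∣ : ∀ a → ∣ sumOver circuit a ∣ ≡ weight (multiplicity (column circuit)) a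
  ∣sumOver-circuit∣ a = trans (cong ∣_∣ circuits≡preimage) (∣preimage∣ (column circuit) (a ·_))
    where
    circuits≡preimage : sumOver circuit a ≡ preimage (column circuit) (a ·_)
    circuits≡preimage = ≗⇒≡ λ x → trans (lookup-sumOver circuit a x) (sym (lookup-preimage (column circuit) (a ·_) x))

  cap⇒6≤weight : IsKCap k s → ∀ a → a ≢ 𝟎 → 6 ≤ weight (multiplicity (column circuit)) a
  cap⇒6≤weight kcap a a≢𝟎 with anyFin? (λ j → lookup a j ≟𝔹 true)
  ... | yes (j , aj) = subst (6 ≤_) (∣sumOver-circuit∣ a)
        (cap-dependency-size s kcap (dependency-sumOver s dependency a) (lookup⇒∈ (trans (lookup-sumOver-point F a j) aj)))
  ... | no ¬aj = ⊥-elim (a≢𝟎 (≗⇒≡ λ j → trans (¬-not (¬aj ∘ (j ,_))) (sym (lookup-𝟎 j))))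

  1≤multiplicity-unit : ∀ j → 1 ≤ multiplicity (column circuit) ⁅ j ⁆
  1≤multiplicity-unit j = ∈⇒1≤∣∣ {u = preimage (column circuit) (λ w → does (w ≟ᵛ ⁅ j ⁆))}
    (lookup⇒∈ (trans (lookup-preimage (column circuit) (λ w → does (w ≟ᵛ ⁅ j ⁆)) (point j)) (dec-true (column circuit (point j) ≟ᵛ ⁅ j ⁆) (column-point j))))

-- A nonzero column v has a · v = 1 for 8 of the 15 nonzero functionals a, and a column other than 𝟎 and u
-- has it for exactly 4 of the 7 nonzero a with a · u = 0. Summing weights of at least 6 over these two sets
-- of functionals leaves room for neither the zero column nor a repeated column.
module _ (N : V 4 → ℕ) (total : ∑ N ≡ 12) (heavy : ∀ a → a ≢ 𝟎 → 6 ≤ weight N a) where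

  private
    N⁺ : ℕ
    N⁺ = ∑ (λ v → 𝟙 (nonzero v) * N v)

    ∑-nonzero : (c : ℕ) → ∑ (λ v → c * 𝟙 (nonzero v) * N v) ≡ c * N⁺
    ∑-nonzero c = trans (∑-cong (λ v → *-assoc c (𝟙 (nonzero v)) (N v))) (∑-*ˡ c (λ v → 𝟙 (nonzero v) * N v))

    heavy-∑ : (A : V 4 → Bool) → (∀ a → T (A a) → a ≢ 𝟎) → ∑ (λ a → 𝟙 (A a) * 6) ≤ ∑ (λ a → 𝟙 (A a) * weight N a)
    heavy-∑ A A⇒≢𝟎 = ∑-mono-≤ bound
      where
      bound : ∀ a → 𝟙 (A a) * 6 ≤ 𝟙 (A a) * weight N a
      bound a with A a in Aa
      ... | true = *-monoʳ-≤ 1 (heavy a (A⇒≢𝟎 a (subst T (sym Aa) _)))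
      ... | false = z≤n

    N𝟎+N⁺≡12 : N 𝟎 + N⁺ ≡ 12
    N𝟎+N⁺≡12 = begin
      N 𝟎 + N⁺                                                    ≡⟨ cong (_+ N⁺) (∑-delta 𝟎 N) ⟨
      ∑ (λ v → 𝟙 (does (𝟎 ≟ᵛ v)) * N v) + N⁺                      ≡⟨ ∑-+ (λ v → 𝟙 (does (𝟎 ≟ᵛ v)) * N v) (λ v → 𝟙 (nonzero v) * N v) ⟨
      ∑ (λ v → 𝟙 (does (𝟎 ≟ᵛ v)) * N v + 𝟙 (nonzero v) * N v)     ≡⟨ ∑-cong (λ v → split (does (𝟎 ≟ᵛ v)) (N v)) ⟨
      ∑ N                                                         ≡⟨ total ⟩
      12                                                          ∎
      where
      open ≡-Reasoning
      split : ∀ b x → x ≡ 𝟙 b * x + 𝟙 (not b) * x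
      split true x = sym (trans (+-identityʳ (x + 0)) (+-identityʳ x))
      split false x = sym (+-identityʳ x)

    ∑-weight-nonzero : ∑ (λ a → 𝟙 (nonzero a) * weight N a) ≡ 8 * N⁺
    ∑-weight-nonzero = trans (∑-weight (𝟙 ∘ nonzero) N) (trans (∑-cong (λ v → cong (_* N v) (coefficients v))) (∑-nonzero 8))
      where
      coefficients : ∀ v → ∑ (λ a → 𝟙 (nonzero a) * 𝟙 (a · v)) ≡ 8 * 𝟙 (nonzero v)
      coefficients = toWitness {a? = allᵛ? (λ v → ∑ (λ a → 𝟙 (nonzero a) * 𝟙 (a · v)) ≟ℕ 8 * 𝟙 (nonzero v))} tt

    ∑-weight-orthogonal : ∀ u → 𝟎 ≢ u → ∑ (λ a → 𝟙 (nonzero a ∧ not (a · u)) * weight N a) + 4 * N u ≡ 4 * N⁺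
    ∑-weight-orthogonal u 𝟎≢u = begin
      ∑ (λ a → 𝟙 (A a) * weight N a) + 4 * N u
        ≡⟨ cong₂ _+_ (∑-weight (𝟙 ∘ A) N) (cong (4 *_) (sym (∑-delta u N))) ⟩
      ∑ (λ v → c v * N v) + 4 * ∑ (λ v → δ v * N v)
        ≡⟨ cong (∑ (λ v → c v * N v) +_) (∑-*ˡ 4 (λ v → δ v * N v)) ⟨
      ∑ (λ v → c v * N v) + ∑ (λ v → 4 * (δ v * N v))
        ≡⟨ ∑-+ (λ v → c v * N v) (λ v → 4 * (δ v * N v)) ⟨
      ∑ (λ v → c v * N v + 4 * (δ v * N v))
        ≡⟨ ∑-cong combine ⟩
      ∑ (λ v → 4 * 𝟙 (nonzero v) * N v)
        ≡⟨ ∑-nonzero 4 ⟩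
      4 * N⁺ ∎
      where
      open ≡-Reasoning
      A : V 4 → Bool
      A a = nonzero a ∧ not (a · u)
      c δ : V 4 → ℕ
      c v = ∑ (λ a → 𝟙 (A a) * 𝟙 (a · v))
      δ v = 𝟙 (does (u ≟ᵛ v))
      coefficients : ∀ v → c v + 4 * δ v ≡ 4 * 𝟙 (nonzero v)
      coefficients = toWitness {a? = allᵛ? λ u → ¬? (𝟎 ≟ᵛ u) →-dec allᵛ? λ v →
        ∑ (λ a → 𝟙 (nonzero a ∧ not (a · u)) * 𝟙 (a · v)) + 4 * 𝟙 (does (u ≟ᵛ v)) ≟ℕ 4 * 𝟙 (nonzero v)} tt u 𝟎≢u
      combine : ∀ v → c v * N v + 4 * (δ v * N v) ≡ 4 * 𝟙 (nonzero v) * N v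
      combine v = begin
        c v * N v + 4 * (δ v * N v)    ≡⟨ cong (c v * N v +_) (*-assoc 4 (δ v) (N v)) ⟨
        c v * N v + 4 * δ v * N v      ≡⟨ *-distribʳ-+ (N v) (c v) (4 * δ v) ⟨
        (c v + 4 * δ v) * N v          ≡⟨ cong (_* N v) (coefficients v) ⟩
        4 * 𝟙 (nonzero v) * N v        ∎

    N⁺≡12 : N⁺ ≡ 12
    N⁺≡12 = ≤-antisym (≤-trans (m≤n+m N⁺ (N 𝟎)) (≤-reflexive N𝟎+N⁺≡12))
                      (*-cancelˡ-< 8 11 N⁺ (≤-trans (n≤1+n 89) (≤-trans (heavy-∑ nonzero (λ _ → nonzero⇒≢𝟎)) (≤-reflexive ∑-weight-nonzero))))

  multiplicity-𝟎 : N 𝟎 ≡ 0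
  multiplicity-𝟎 = +-cancelʳ-≡ N⁺ (N 𝟎) 0 (trans N𝟎+N⁺≡12 (sym N⁺≡12))

  multiplicity-≤1 : ∀ u → N u ≤ 1
  multiplicity-≤1 u with 𝟎 ≟ᵛ u
  ... | yes refl = subst (_≤ 1) (sym multiplicity-𝟎) z≤n
  ... | no 𝟎≢u = ≤-pred (*-cancelˡ-< 4 (N u) 2 (≤-trans (s≤s (+-cancelˡ-≤ 42 (4 * N u) 6 bound)) (n≤1+n 7)))
    where
    A : V 4 → Bool
    A a = nonzero a ∧ not (a · u)

    |A|≡7 : ∑ (λ a → 𝟙 (A a) * 6) ≡ 42
    |A|≡7 = toWitness {a? = allᵛ? λ u → ¬? (𝟎 ≟ᵛ u) →-dec ∑ (λ a → 𝟙 (nonzero a ∧ not (a · u)) * 6) ≟ℕ 42} tt u 𝟎≢u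

    bound : 42 + 4 * N u ≤ 48
    bound = ≤-trans (+-monoˡ-≤ (4 * N u) (subst (_≤ ∑ (λ a → 𝟙 (A a) * weight N a)) |A|≡7
                                            (heavy-∑ A (λ a Aa → nonzero⇒≢𝟎 (proj₁ (Equivalence.to T-∧ Aa))))))
                    (≤-reflexive (trans (∑-weight-orthogonal u 𝟎≢u) (cong (4 *_) N⁺≡12)))

-- Exchanging the dependent points

isNew : (Fin m → V m) → V m → Bool
isNew v w = does (anyFin? (λ j → w ≟ᵛ v j))

newRepresentation : (v a : Fin m → V m) → Fin m → V m → Bool
newRepresentation v a i w = a i · w ∧ not (does (w ≟ᵛ v i))

-- v lists the columns of the new dependent points and a their dual functionals (a i · v j = δᵢⱼ).
module Exchange {s : Fin k → V n} {p : Subset k} (F : FundamentalCircuits s p m) (indep : AffIndep s p)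
  (v a : Fin m → V m)
  (present  : ∀ i → multiplicity (column (FundamentalCircuits.circuit F)) (v i) ≡ 1)
  (dual     : ∀ i j → a i · v j ≡ does (i ≟ᶠ j))
  (spanning : ∀ b → (∀ j → b · v j ≡ false) → b ≡ 𝟎) where

  open FundamentalCircuits F

  col : Fin k → V m
  col = column circuit

  p′ : Subset k
  p′ = preimage col (not ∘ isNew v)

  point′ : Fin m → Fin k
  point′ j = proj₁ (unique-preimage col (present j))

  col-point′ : ∀ j → col (point′ j) ≡ v j
  col-point′ j = proj₁ (proj₂ (unique-preimage col (present j)))

  point′-unique : ∀ j {y} → col y ≡ v j → y ≡ point′ j
  point′-unique j = proj₂ (proj₂ (unique-preimage col (present j)))

  circuit′ : Fin m → Subset k
  circuit′ i = sumOver circuit (a i)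

  lookup-circuit′-point′ : ∀ i j → lookup (circuit′ i) (point′ j) ≡ does (i ≟ᶠ j)
  lookup-circuit′-point′ i j = trans (lookup-sumOver circuit (a i) (point′ j)) (trans (cong (a i ·_) (col-point′ j)) (dual i j))

  point′∉p′ : ∀ j → point′ j ∉ p′
  point′∉p′ j j∈p′ = contradiction (begin
    true                           ≡⟨ ∈⇒lookup j∈p′ ⟨
    lookup p′ (point′ j)           ≡⟨ lookup-preimage col (not ∘ isNew v) (point′ j) ⟩
    not (isNew v (col (point′ j))) ≡⟨ cong (not ∘ isNew v) (col-point′ j) ⟩
    not (isNew v (v j))            ≡⟨ cong not (dec-true (anyFin? (λ i → v j ≟ᵛ v i)) (j , refl)) ⟩
    false                          ∎) λ ()
    where open ≡-Reasoning

  ∉p′⇒point′ : ∀ {x} → x ∉ p′ → ∃ λ j → point′ j ≡ x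
  ∉p′⇒point′ {x} x∉p′ =
    let j , col-x≡v-j = does⇒ (anyFin? (λ i → col x ≟ᵛ v i))
                          (trans (sym (not-involutive _)) (trans (cong not (sym (lookup-preimage col (not ∘ isNew v) x))) (cong not (∉⇒lookup x∉p′))))
    in j , sym (point′-unique j col-x≡v-j)

  F′ : FundamentalCircuits s p′ m
  F′ = record
    { point = point′
    ; circuit = circuit′
    ; dependency = dependency-sumOver s dependency ∘ a
    ; column-point = λ j → ≗⇒≡ λ i → trans (lookup∘tabulate _ i) (trans (lookup-circuit′-point′ i j) (sym (lookup-⁅⁆ j i)))
    ; point∉ = point′∉p′
    ; ∉⇒point = ∉p′⇒point′ }

  independent′ : AffIndep s p′
  independent′ = dependency≡𝟎⇒independent s λ {u} dep u⊆p′ →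
    let b = restrict u point
        orthogonal : ∀ j → b · v j ≡ false
        orthogonal j = begin
          b · v j                            ≡⟨ cong (b ·_) (col-point′ j) ⟨
          b · col (point′ j)                 ≡⟨ lookup-sumOver circuit b (point′ j) ⟨
          lookup (sumOver circuit b) (point′ j) ≡⟨ cong (λ w → lookup w (point′ j)) (dependency-coordinates F indep dep) ⟨
          lookup u (point′ j)                ≡⟨ ∉⇒lookup (point′∉p′ j ∘ u⊆p′) ⟩
          false                              ∎
    in begin
      u                  ≡⟨ dependency-coordinates F indep dep ⟩
      sumOver circuit b  ≡⟨ cong (sumOver circuit) (spanning b orthogonal) ⟩
      sumOver circuit 𝟎  ≡⟨ sumOver-𝟎 circuit ⟩
      𝟎                  ∎
    where open ≡-Reasoning

  representation′ : ∀ i → FundamentalCircuits.representation F′ i ≡ preimage col (newRepresentation v a i)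
  representation′ i = ≗⇒≡ λ x → begin
    lookup (circuit′ i ⊕ ⁅ point′ i ⁆) x              ≡⟨ lookup-⊕ (circuit′ i) ⁅ point′ i ⁆ x ⟩
    lookup (circuit′ i) x xor lookup ⁅ point′ i ⁆ x   ≡⟨ cong₂ _xor_ (lookup-sumOver circuit (a i) x) (trans (lookup-⁅⁆ (point′ i) x) (same-test x)) ⟩
    (a i · col x) xor does (col x ≟ᵛ v i)            ≡⟨ xor≡∧not _ _ (λ eq → trans (cong (a i ·_) (does⇒ (col x ≟ᵛ v i) eq)) (trans (dual i i) (dec-true (i ≟ᶠ i) refl))) ⟩
    (a i · col x) ∧ not (does (col x ≟ᵛ v i))        ≡⟨ lookup-preimage col (newRepresentation v a i) x ⟨
    lookup (preimage col (newRepresentation v a i)) x ∎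
    where
    open ≡-Reasoning
    same-test : ∀ x → does (x ≟ᶠ point′ i) ≡ does (col x ≟ᵛ v i)
    same-test x with x ≟ᶠ point′ i | col x ≟ᵛ v i
    ... | yes refl | yes _ = refl
    ... | yes refl | no col≢v = ⊥-elim (col≢v (col-point′ i))
    ... | no x≢point | yes col≡v = ⊥-elim (x≢point (point′-unique i col≡v))
    ... | no _ | no _ = refl
    xor≡∧not : ∀ b c → (c ≡ true → b ≡ true) → b xor c ≡ b ∧ not c
    xor≡∧not b false _ = trans (xor-identityʳ b) (sym (∧-identityʳ b))
    xor≡∧not b true c⇒b with refl ← c⇒b refl = refl

  ∣representation′∣ : ∀ i → ∣ FundamentalCircuits.representation F′ i ∣ ≡ count (newRepresentation v a i) (multiplicity col)
  ∣representation′∣ i = trans (cong ∣_∣ (representation′ i)) (∣preimage∣ col (newRepresentation v a i))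

  ∣representation′∩representation′∣ : ∀ i j →
    ∣ FundamentalCircuits.representation F′ i ∩ FundamentalCircuits.representation F′ j ∣ ≡
    count (λ w → newRepresentation v a i w ∧ newRepresentation v a j w) (multiplicity col)
  ∣representation′∩representation′∣ i j = trans
    (cong ∣_∣ (trans (cong₂ _∩_ (representation′ i) (representation′ j)) (preimage-∩ col (newRepresentation v a i) (newRepresentation v a j))))
    (∣preimage∣ col (λ w → newRepresentation v a i w ∧ newRepresentation v a j w))

  ∣∁p′∣ : ∣ ∁ p′ ∣ ≡ count (isNew v) (multiplicity col)
  ∣∁p′∣ = trans (cong ∣_∣ (trans (∁-preimage col (not ∘ isNew v)) (tabulate-cong (not-involutive ∘ isNew v ∘ col))))
                (∣preimage∣ col (isNew v))

module _ {s : Fin k → V n} {p : Subset k} (F : FundamentalCircuits s p 4) where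
  open FundamentalCircuits F

  private
    B : Fin 4 → Subset k
    B = representation

  fundamentalCircuits⇒hasExtType : ∀ {n₁ n₂ n₃ n₄ m₁₂ m₁₃ m₁₄ m₂₃ m₂₄ m₃₄} → ∣ ∁ p ∣ ≡ 4 →
    ∣ B (# 0) ∣ ≡ n₁ → ∣ B (# 1) ∣ ≡ n₂ → ∣ B (# 2) ∣ ≡ n₃ → ∣ B (# 3) ∣ ≡ n₄ →
    ∣ B (# 0) ∩ B (# 1) ∣ ≡ m₁₂ → ∣ B (# 0) ∩ B (# 2) ∣ ≡ m₁₃ → ∣ B (# 0) ∩ B (# 3) ∣ ≡ m₁₄ →
    ∣ B (# 1) ∩ B (# 2) ∣ ≡ m₂₃ → ∣ B (# 1) ∩ B (# 3) ∣ ≡ m₂₄ → ∣ B (# 2) ∩ B (# 3) ∣ ≡ m₃₄ →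
    HasExtType s p n₁ n₂ n₃ n₄ m₁₂ m₁₃ m₁₄ m₂₃ m₂₄ m₃₄
  fundamentalCircuits⇒hasExtType ∣∁p∣≡4 n₁ n₂ n₃ n₄ m₁₂ m₁₃ m₁₄ m₂₃ m₂₄ m₃₄ =
    ∣∁p∣≡4 ,
    point (# 0) , point (# 1) , point (# 2) , point (# 3) ,
    outside (# 0) , outside (# 1) , outside (# 2) , outside (# 3) ,
    distinct (λ ()) , distinct (λ ()) , distinct (λ ()) , distinct (λ ()) , distinct (λ ()) , distinct (λ ()) ,
    B (# 0) , B (# 1) , B (# 2) , B (# 3) ,
    representation⊆p F (# 0) , representation⊆p F (# 1) , representation⊆p F (# 2) , representation⊆p F (# 3) ,
    sumOver-representation F (# 0) , sumOver-representation F (# 1) ,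
    sumOver-representation F (# 2) , sumOver-representation F (# 3) ,
    n₁ , n₂ , n₃ , n₄ , m₁₂ , m₁₃ , m₁₄ , m₂₃ , m₂₄ , m₃₄
    where
    outside : ∀ j → point j ∈ ∁ p
    outside j = x∉p⇒x∈∁p (point∉ j)
    distinct : ∀ {i j} → i ≢ j → point i ≢ point j
    distinct i≢j = i≢j ∘ point-injective F

-- The finite classification

data Table (A : Set) : ℕ → Set where
  leaf : A → Table A zero
  node : Table A m → Table A m → Table A (suc m)

_!_ : {A : Set} → Table A m → V m → A
leaf x ! [] = x
node t₀ t₁ ! (false ∷ v) = t₀ ! v
node t₀ t₁ ! (true ∷ v) = t₁ ! v

tabulateᵀ : {A : Set} → (V m → A) → Table A m
tabulateᵀ {zero} f = leaf (f [])
tabulateᵀ {suc m} f = node (tabulateᵀ (f ∘ (false ∷_))) (tabulateᵀ (f ∘ (true ∷_)))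

!-tabulateᵀ : {A : Set} (f : V m → A) (v : V m) → tabulateᵀ f ! v ≡ f v
!-tabulateᵀ f [] = refl
!-tabulateᵀ f (false ∷ v) = !-tabulateᵀ (f ∘ (false ∷_)) v
!-tabulateᵀ f (true ∷ v) = !-tabulateᵀ (f ∘ (true ∷_)) v

-- A pattern fixes some entries of a table (just b) and leaves the others free (nothing).
Matches : Table (Maybe Bool) m → Table Bool m → Set
Matches (leaf e) (leaf b) = AllMaybe (_≡ b) e
Matches (node π₀ π₁) (node t₀ t₁) = Matches π₀ t₀ × Matches π₁ t₁

matches-tabulateᵀ : (π : V m → Maybe Bool) (f : V m → Bool) → (∀ v → AllMaybe (_≡ f v) (π v)) → Matches (tabulateᵀ π) (tabulateᵀ f)
matches-tabulateᵀ {zero} π f agree = agree []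
matches-tabulateᵀ {suc m} π f agree =
  matches-tabulateᵀ (π ∘ (false ∷_)) (f ∘ (false ∷_)) (agree ∘ (false ∷_)) ,
  matches-tabulateᵀ (π ∘ (true ∷_)) (f ∘ (true ∷_)) (agree ∘ (true ∷_))

∀-matching? : (π : Table (Maybe Bool) m) {P : Table Bool m → Set} → Decidable P → Dec (∀ t → Matches π t → P t)
∀-matching? (leaf nothing) P? =
  map′ (λ { (f , t) (leaf false) _ → f ; (f , t) (leaf true) _ → t }) (λ h → h (leaf false) nothing , h (leaf true) nothing)
       (P? (leaf false) ×-dec P? (leaf true))
∀-matching? (leaf (just b)) P? =
  map′ (λ { Pb (leaf .b) (just refl) → Pb }) (λ h → h (leaf b) (just refl)) (P? (leaf b))
∀-matching? (node π₀ π₁) P? =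
  map′ (λ { h (node t₀ t₁) (m₀ , m₁) → h t₀ m₀ t₁ m₁ }) (λ h t₀ m₀ t₁ m₁ → h (node t₀ t₁) (m₀ , m₁))
       (∀-matching? π₀ λ t₀ → ∀-matching? π₁ λ t₁ → P? (node t₀ t₁))

record Exchangeable (N : V 4 → ℕ) (v a : Fin 4 → V 4) : Set where
  private
    B = newRepresentation v a
    meet : Fin 4 → Fin 4 → ℕ
    meet i j = count (λ w → B i w ∧ B j w) N
  field
    present  : ∀ i → N (v i) ≡ 1
    dual     : ∀ i j → a i · v j ≡ does (i ≟ᶠ j)
    spanning : ∀ b → (∀ j → b · v j ≡ false) → b ≡ 𝟎
    removed  : count (isNew v) N ≡ 4
    size     : ∀ i → count (B i) N ≡ 5
    meet₀₁   : meet (# 0) (# 1) ≡ 2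
    meet₀₂   : meet (# 0) (# 2) ≡ 3
    meet₀₃   : meet (# 0) (# 3) ≡ 3
    meet₁₂   : meet (# 1) (# 2) ≡ 3
    meet₁₃   : meet (# 1) (# 3) ≡ 3
    meet₂₃   : meet (# 2) (# 3) ≡ 3

exchangeable? : ∀ N v a → Dec (Exchangeable N v a)
exchangeable? N v a = map′
  (λ (pr , du , sp , re , si , m₀₁ , m₀₂ , m₀₃ , m₁₂ , m₁₃ , m₂₃) → record
    { present = pr ; dual = du ; spanning = sp ; removed = re ; size = si
    ; meet₀₁ = m₀₁ ; meet₀₂ = m₀₂ ; meet₀₃ = m₀₃ ; meet₁₂ = m₁₂ ; meet₁₃ = m₁₃ ; meet₂₃ = m₂₃ })
  (λ E → let open Exchangeable E in present , dual , spanning , removed , size , meet₀₁ , meet₀₂ , meet₀₃ , meet₁₂ , meet₁₃ , meet₂₃)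
  (all? (λ i → N (v i) ≟ℕ 1) ×-dec
   all? (λ i → all? λ j → a i · v j ≟𝔹 does (i ≟ᶠ j)) ×-dec
   allᵛ? (λ b → all? (λ j → b · v j ≟𝔹 false) →-dec b ≟ᵛ 𝟎) ×-dec
   count (isNew v) N ≟ℕ 4 ×-dec
   all? (λ i → count (B i) N ≟ℕ 5) ×-dec
   meet (# 0) (# 1) ≟ℕ 2 ×-dec meet (# 0) (# 2) ≟ℕ 3 ×-dec meet (# 0) (# 3) ≟ℕ 3 ×-dec
   meet (# 1) (# 2) ≟ℕ 3 ×-dec meet (# 1) (# 3) ≟ℕ 3 ×-dec meet (# 2) (# 3) ≟ℕ 3)
  where
  B = newRepresentation v a
  meet : Fin 4 → Fin 4 → ℕ
  meet i j = count (λ w → B i w ∧ B j w) N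

exchangeable-cong : {N N′ : V 4 → ℕ} {v a : Fin 4 → V 4} → (∀ w → N w ≡ N′ w) → Exchangeable N′ v a → Exchangeable N v a
exchangeable-cong {N} {N′} {v} {a} N≗N′ E = record
  { present = λ i → trans (N≗N′ (v i)) (present i) ; dual = dual ; spanning = spanning
  ; removed = moved (isNew v) removed ; size = λ i → moved (B i) (size i)
  ; meet₀₁ = moved-meet (# 0) (# 1) meet₀₁ ; meet₀₂ = moved-meet (# 0) (# 2) meet₀₂ ; meet₀₃ = moved-meet (# 0) (# 3) meet₀₃
  ; meet₁₂ = moved-meet (# 1) (# 2) meet₁₂ ; meet₁₃ = moved-meet (# 1) (# 3) meet₁₃ ; meet₂₃ = moved-meet (# 2) (# 3) meet₂₃ }
  where
  open Exchangeable E
  B = newRepresentation v a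
  moved : ∀ P {c} → count P N′ ≡ c → count P N ≡ c
  moved P = trans (count-cong P N≗N′)
  moved-meet : ∀ i j {c} → count (λ w → B i w ∧ B j w) N′ ≡ c → count (λ w → B i w ∧ B j w) N ≡ c
  moved-meet i j = moved (λ w → B i w ∧ B j w)

Admissible : (V 4 → ℕ) → Set
Admissible N = ∑ N ≡ 12 × (∀ a → a ≢ 𝟎 → 6 ≤ weight N a)

admissible? : ∀ N → Dec (Admissible N)
admissible? N = ∑ N ≟ℕ 12 ×-dec allᵛ? (λ a → ¬? (a ≟ᵛ 𝟎) →-dec 6 ≤? weight N a)

-- One candidate exchange (new dependent columns, dual functionals) for each of the 13 admissible
-- configurations, found by computer search. Columns are written as binary numbers, the first
-- coordinate being the least significant bit.
candidates : List ((Fin 4 → V 4) × (Fin 4 → V 4))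
candidates = List.map (λ (vs , as) → columns vs , columns as)
  ( (8 ∷ 4 ∷ 2 ∷ 1 ∷ [] ,  8 ∷ 4 ∷ 2 ∷ 1 ∷ [])
  ∷ (8 ∷ 4 ∷ 2 ∷ 9 ∷ [] ,  9 ∷ 4 ∷ 2 ∷ 1 ∷ [])
  ∷ (8 ∷ 4 ∷ 2 ∷ 5 ∷ [] ,  8 ∷ 5 ∷ 2 ∷ 1 ∷ [])
  ∷ (8 ∷ 4 ∷ 10 ∷ 1 ∷ [] , 10 ∷ 4 ∷ 2 ∷ 1 ∷ [])
  ∷ (8 ∷ 4 ∷ 10 ∷ 9 ∷ [] , 11 ∷ 4 ∷ 2 ∷ 1 ∷ [])
  ∷ (8 ∷ 4 ∷ 10 ∷ 5 ∷ [] , 10 ∷ 5 ∷ 2 ∷ 1 ∷ [])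
  ∷ (8 ∷ 4 ∷ 6 ∷ 1 ∷ [] ,  8 ∷ 6 ∷ 2 ∷ 1 ∷ [])
  ∷ (8 ∷ 4 ∷ 6 ∷ 9 ∷ [] ,  9 ∷ 6 ∷ 2 ∷ 1 ∷ [])
  ∷ (8 ∷ 4 ∷ 6 ∷ 5 ∷ [] ,  8 ∷ 7 ∷ 2 ∷ 1 ∷ [])
  ∷ (8 ∷ 2 ∷ 6 ∷ 1 ∷ [] ,  8 ∷ 6 ∷ 4 ∷ 1 ∷ [])
  ∷ (8 ∷ 2 ∷ 6 ∷ 9 ∷ [] ,  9 ∷ 6 ∷ 4 ∷ 1 ∷ [])
  ∷ (8 ∷ 2 ∷ 6 ∷ 3 ∷ [] ,  8 ∷ 7 ∷ 4 ∷ 1 ∷ [])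
  ∷ (8 ∷ 1 ∷ 5 ∷ 3 ∷ [] ,  8 ∷ 7 ∷ 4 ∷ 2 ∷ [])
  ∷ [])
  where
  binary : ∀ m → ℕ → V m
  binary zero _ = []
  binary (suc m) x = (x % 2 ≡ᵇ 1) ∷ binary m (x / 2)

  columns : Vec ℕ 4 → Fin 4 → V 4
  columns xs = lookup (Vec.map (binary 4) xs)

-- The zero column never occurs and each unit column occurs.
template : Table (Maybe Bool) 4
template = tabulateᵀ λ v → if ∣ v ∣ ≤ᵇ 1 then just (nonzero v) else nothing

-- Opaque, so that unification elsewhere never unfolds the decision procedure.
opaque
  classification : ∀ t → Matches template t → Admissible (𝟙 ∘ (t !_)) →
                   Any (λ (v , a) → Exchangeable (𝟙 ∘ (t !_)) v a) candidates
  classification = toWitness {a? = ∀-matching? template λ t →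
    admissible? (𝟙 ∘ (t !_)) →-dec any? (λ (v , a) → exchangeable? (𝟙 ∘ (t !_)) v a) candidates} tt

exchange-exists : (N : V 4 → ℕ) → ∑ N ≡ 12 → (∀ a → a ≢ 𝟎 → 6 ≤ weight N a) → (∀ j → 1 ≤ N ⁅ j ⁆) →
                  Σ (Fin 4 → V 4) λ v → Σ (Fin 4 → V 4) λ a → Exchangeable N v a
exchange-exists N total heavy units =
  let (v , a) , E = satisfied (classification t matches admissible) in v , a , exchangeable-cong N≗t E
  where
  t : Table Bool 4
  t = tabulateᵀ λ w → N w ≡ᵇ 1

  N≗t : ∀ w → N w ≡ 𝟙 (t ! w)
  N≗t w = trans (bit (multiplicity-≤1 N total heavy w)) (cong 𝟙 (sym (!-tabulateᵀ (λ w → N w ≡ᵇ 1) w)))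
    where
    bit : ∀ {x} → x ≤ 1 → x ≡ 𝟙 (x ≡ᵇ 1)
    bit z≤n = refl
    bit (s≤s z≤n) = refl

  agree : ∀ w → AllMaybe (_≡ (N w ≡ᵇ 1)) (if ∣ w ∣ ≤ᵇ 1 then just (nonzero w) else nothing)
  agree w with ∣ w ∣ in ∣w∣≡
  ... | 0 with refl ← ∣p∣≡0⇒p≡𝟎 w ∣w∣≡ = just (cong (_≡ᵇ 1) (sym (multiplicity-𝟎 N total heavy)))
  ... | 1 with j , refl ← ∣p∣≡1⇒p≡⁅x⁆ w ∣w∣≡ =
    just (trans (cong not (dec-false (𝟎 ≟ᵛ ⁅ j ⁆) 𝟎≢⁅j⁆)) (cong (_≡ᵇ 1) (sym (≤-antisym (multiplicity-≤1 N total heavy ⁅ j ⁆) (units j)))))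
    where
    𝟎≢⁅j⁆ : 𝟎 ≢ ⁅ j ⁆
    𝟎≢⁅j⁆ eq = contradiction (trans (sym (lookup-𝟎 j)) (trans (cong (λ u → lookup u j) eq) (∈⇒lookup (x∈⁅x⁆ j)))) λ ()
  ... | suc (suc _) = nothing

  matches : Matches template t
  matches = matches-tabulateᵀ _ _ agree

  admissible : Admissible (𝟙 ∘ (t !_))
  admissible = trans (sym (∑-cong N≗t)) total , λ a a≢𝟎 → subst (6 ≤_) (count-cong (a ·_) N≗t) (heavy a a≢𝟎)

proposition7p7 : ∀ (n : ℕ) (s : Fin 12 → V n) → IsKCap 12 s → HasDim s 7 →
    Σ (Subset 12) λ p → IsBasis s p × HasExtType s p 5 5 5 5 2 3 3 3 3 3
proposition7p7 n s kcap (p , basis-p@(indep , _) , ∣p∣≡8) =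
  p′ , fundamentalCircuits⇒basis F′ independent′ ,
  fundamentalCircuits⇒hasExtType F′ (trans ∣∁p′∣ removed)
    (size′ (# 0)) (size′ (# 1)) (size′ (# 2)) (size′ (# 3))
    (meet′ (# 0) (# 1) meet₀₁) (meet′ (# 0) (# 2) meet₀₂) (meet′ (# 0) (# 3) meet₀₃)
    (meet′ (# 1) (# 2) meet₁₂) (meet′ (# 1) (# 3) meet₁₃) (meet′ (# 2) (# 3) meet₂₃)
  where
  F = basis⇒fundamentalCircuits basis-p (trans (∣∁p∣≡n∸∣p∣ p) (cong (12 ∸_) ∣p∣≡8))
  N = multiplicity (column (FundamentalCircuits.circuit F))
  exchange = exchange-exists N (∑-multiplicity (column (FundamentalCircuits.circuit F))) (cap⇒6≤weight F kcap) (1≤multiplicity-unit F)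
  v = proj₁ exchange
  a = proj₁ (proj₂ exchange)
  open Exchangeable (proj₂ (proj₂ exchange))
  open Exchange F indep v a present dual spanning
  open FundamentalCircuits F′ using () renaming (representation to B′)
  size′ : ∀ i → ∣ B′ i ∣ ≡ 5
  size′ i = trans (∣representation′∣ i) (size i)
  meet′ : ∀ i j {c} → count (λ w → newRepresentation v a i w ∧ newRepresentation v a j w) N ≡ c → ∣ B′ i ∩ B′ j ∣ ≡ c
  meet′ i j = trans (∣representation′∩representation′∣ i j)
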